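{- In the setting described in the context, if a bin of a feasible solution of BPUP' contains at least one late item, then the bin contains a set of $k$ consecutive early items (consecutive in the bin's sorted order) whose total size plus $U$ is at most $\varepsilon$.
   Context: Let $\varepsilon>0$ with $1/\varepsilon\in\mathbb{Z}$, $k$ a positive integer and $U\in(0,1]$ rational. Items have sizes $s_i\in[0,1]$ and bins have capacity $1$. Problem BPUP': for a bin $p$, sort its items in non-increasing order of size, ties broken by increasing index; the early items $E_p$ are the first $k/\varepsilon$ items in this order and the late items $\Lambda_p$ are the remaining ones. A late item has modified size $\tilde s_i=s_i+U/k$. The load of $p$ is $\sum_{i\in E_p}s_i+\sum_{i\in\Lambda_p}\tilde s_i+\frac{|E_p|}{k}U$ if $\Lambda_p\ne\emptyset$, and $\sum_{i\in E_p}s_i+\lfloor(|E_p|-1)/k\rfloor U$ if $\Lambda_p=\emptyset$. A feasible solution of BPUP' is a partition of the items into bins each of load at most $1$.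
   Formalization: The item sizes $s_i$ are rational numbers in [0,1]. -}

module Defs where

open import Data.Bool using (Bool; true; false; _∨_; _∧_; if_then_else_)
open import Data.Nat as ℕ using (ℕ; zero; suc; NonZero)
open import Data.Integer as ℤ using (ℤ; +_; _/ℕ_)
open import Data.Rational as ℚ using (ℚ; 0ℚ; 1ℚ; _+_; _*_; _/_)
open import Data.Rational.Properties using (_<?_; _≟_)
open import Data.Fin using (Fin; toℕ)
open import Data.List using (List; []; _∷_; foldr; map; take; drop; length; filter; allFin)
open import Relation.Nullary.Decidable using (⌊_⌋; does)
import Data.Nat.Properties as ℕP

sumℚ : List ℚ → ℚ
sumℚ = foldr _+_ 0ℚ

module BPUP (n : ℕ) (s : Fin n → ℚ) (M : ℕ) .{{_ : NonZero M}}
            (k : ℕ) .{{_ : NonZero k}} (U : ℚ) where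
  -- ε = 1 / M   (ε > 0 with 1/ε ∈ ℤ)
  ε : ℚ
  ε = + 1 / M

  before : Fin n → Fin n → Bool
  before i j = ⌊ s j <? s i ⌋ ∨ (⌊ s i ≟ s j ⌋ ∧ ⌊ toℕ i ℕ.<? toℕ j ⌋)

  insert : Fin n → List (Fin n) → List (Fin n)
  insert i [] = i ∷ []
  insert i (j ∷ js) = if before i j then i ∷ j ∷ js else j ∷ insert i js

  sortItems : List (Fin n) → List (Fin n)
  sortItems = foldr insert []

  Assignment : Set
  Assignment = Fin n → ℕ

  binOrder : Assignment → ℕ → List (Fin n)
  binOrder bin p = sortItems (filter (λ i → bin i ℕ.≟ p) (allFin n))

  -- early items: the first k/ε = k * M items; late items: the rest
  early : Assignment → ℕ → List (Fin n)
  early bin p = take (k ℕ.* M) (binOrder bin p)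

  late : Assignment → ℕ → List (Fin n)
  late bin p = drop (k ℕ.* M) (binOrder bin p)

  s~ : Fin n → ℚ
  s~ i = s i + U * (+ 1 / k)

  load : Assignment → ℕ → ℚ
  load bin p with late bin p
  ... | [] = sumℚ (map s (early bin p))
             + (((+ length (early bin p) ℤ.- + 1) /ℕ k) / 1) * U
  ... | Λ@(_ ∷ _) = sumℚ (map s (early bin p)) + sumℚ (map s~ Λ)
             + (+ length (early bin p) / k) * U

  Feasible : Assignment → Set
  Feasible bin = ∀ p → load bin p ℚ.≤ 1ℚ

-- Since the bin has a late item, its load strictly exceeds the cost of its early items,
-- Σ E + (|E|/k)·U = Σ E + M·U with M = 1/ε and |E| = k·M; feasibility thus gives
-- Σ E + M·U < 1 = M·ε. Cutting E into M consecutive blocks of k items, the block sums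
-- add up to Σ E, so by averaging some block has sum + U ≤ ε.
module Submission where

open import Algebra.Bundles using (CommutativeMonoid; CommutativeRing)
open import Data.Empty using (⊥-elim)
open import Data.Fin using (Fin)
open import Data.Integer as ℤ using (+_)
import Data.Integer.Properties as ℤP
open import Data.List using (List; []; _∷_; _++_; map; take; drop; length)
import Data.List.Properties as List
open import Data.Nat as ℕ using (ℕ; zero; suc; NonZero)
import Data.Nat.Properties as ℕP
open import Data.Product using (∃; _×_; _,_; proj₁)
open import Data.Rational as ℚ using (ℚ; 0ℚ; 1ℚ; _+_; _*_; _/_; _<_; _≤_; toℚᵘ; fromℚᵘ)
open import Data.Rational.Properties
import Data.Rational.Unnormalised as ℚᵘ
import Data.Rational.Unnormalised.Properties as ℚᵘP
open import Function using (_∘_)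
open import Relation.Binary.PropositionalEquality
open import Relation.Nullary using (yes; no)

open import Algebra.Properties.CommutativeSemigroup
  (CommutativeMonoid.commutativeSemigroup +-0-commutativeMonoid) using (interchange)
open import Algebra.Properties.Semiring.Mult (CommutativeRing.semiring +-*-commutativeRing)
  using (×-assoc-*) renaming (_×_ to _·_)

open import Defs using (sumℚ; module BPUP)

fromℚᵘ-homo-+ : ∀ p q → fromℚᵘ (p ℚᵘ.+ q) ≡ fromℚᵘ p + fromℚᵘ q
fromℚᵘ-homo-+ p q = toℚᵘ-injective (begin-equality
  toℚᵘ (fromℚᵘ (p ℚᵘ.+ q))                ≃⟨ toℚᵘ-fromℚᵘ (p ℚᵘ.+ q) ⟩
  p ℚᵘ.+ q                                ≃⟨ ℚᵘP.+-cong (ℚᵘP.≃-sym (toℚᵘ-fromℚᵘ p)) (ℚᵘP.≃-sym (toℚᵘ-fromℚᵘ q)) ⟩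
  toℚᵘ (fromℚᵘ p) ℚᵘ.+ toℚᵘ (fromℚᵘ q)    ≃⟨ toℚᵘ-homo-+ (fromℚᵘ p) (fromℚᵘ q) ⟨
  toℚᵘ (fromℚᵘ p + fromℚᵘ q)              ∎)
  where open ℚᵘP.≤-Reasoning

/-cross : ∀ i j m n .{{_ : NonZero m}} .{{_ : NonZero n}} → i ℤ.* + n ≡ j ℤ.* + m → i / m ≡ j / n
/-cross i j (suc m) (suc n) eq = fromℚᵘ-cong {ℚᵘ.mkℚᵘ i m} {ℚᵘ.mkℚᵘ j n} (ℚᵘ.*≡* eq)

i/n+j/n≡[i+j]/n : ∀ i j n .{{_ : NonZero n}} → i / n + j / n ≡ (i ℤ.+ j) / n
i/n+j/n≡[i+j]/n i j n@(suc _) = begin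
  i / n + j / n                      ≡⟨ fromℚᵘ-homo-+ (i ℚᵘ./ n) (j ℚᵘ./ n) ⟨
  fromℚᵘ (i ℚᵘ./ n ℚᵘ.+ j ℚᵘ./ n)    ≡⟨ fromℚᵘ-cong {_} {(i ℤ.+ j) ℚᵘ./ n} sum≃ ⟩
  (i ℤ.+ j) / n                      ∎
  where
  open ≡-Reasoning
  sum≃ : i ℚᵘ./ n ℚᵘ.+ j ℚᵘ./ n ℚᵘ.≃ (i ℤ.+ j) ℚᵘ./ n
  sum≃ = ℚᵘP.≃-trans
    (ℚᵘP.≃-reflexive (cong (ℚᵘ._/ (n ℕ.* n)) (sym (ℤP.*-distribʳ-+ (+ n) i j))))
    (ℚᵘP.*-cancelʳ-/ n)

m·[i/n]≡[m*i]/n : ∀ m i n .{{_ : NonZero n}} → m · (i / n) ≡ (+ m ℤ.* i) / n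
m·[i/n]≡[m*i]/n zero    i n = /-cross (+ 0) (+ 0 ℤ.* i) 1 n (ℤP.*-zeroˡ (+ n))
m·[i/n]≡[m*i]/n (suc m) i n = begin
  i / n + m · (i / n)        ≡⟨ cong (λ q → i / n + q) (m·[i/n]≡[m*i]/n m i n) ⟩
  i / n + (+ m ℤ.* i) / n    ≡⟨ i/n+j/n≡[i+j]/n i (+ m ℤ.* i) n ⟩
  (i ℤ.+ + m ℤ.* i) / n      ≡⟨ cong (_/ n) (ℤP.suc-* (+ m) i) ⟨
  (+ suc m ℤ.* i) / n        ∎
  where open ≡-Reasoning

m·[1/m]≡1 : ∀ m .{{_ : NonZero m}} → m · (+ 1 / m) ≡ 1ℚ
m·[1/m]≡1 m = trans (m·[i/n]≡[m*i]/n m (+ 1) m) (/-cross (+ m ℤ.* + 1) (+ 1) m 1 cross)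
  where
  cross : (+ m ℤ.* + 1) ℤ.* + 1 ≡ + 1 ℤ.* + m
  cross = trans (ℤP.*-identityʳ _) (trans (ℤP.*-identityʳ (+ m)) (sym (ℤP.*-identityˡ (+ m))))

[k*m/k]*x≡m·x : ∀ k m .{{_ : NonZero k}} x → (+ (k ℕ.* m) / k) * x ≡ m · x
[k*m/k]*x≡m·x k m x = begin
  (+ (k ℕ.* m) / k) * x    ≡⟨ cong (_* x) (/-cross (+ (k ℕ.* m)) (+ m ℤ.* + 1) k 1 cross) ⟩
  ((+ m ℤ.* + 1) / 1) * x  ≡⟨ cong (_* x) (m·[i/n]≡[m*i]/n m (+ 1) 1) ⟨
  (m · 1ℚ) * x             ≡⟨ ×-assoc-* m 1ℚ x ⟩
  m · (1ℚ * x)             ≡⟨ cong (m ·_) (*-identityˡ x) ⟩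
  m · x                    ∎
  where
  open ≡-Reasoning
  cross : + (k ℕ.* m) ℤ.* + 1 ≡ (+ m ℤ.* + 1) ℤ.* + k
  cross = begin
    + (k ℕ.* m) ℤ.* + 1     ≡⟨ ℤP.*-identityʳ _ ⟩
    + (k ℕ.* m)             ≡⟨ cong +_ (ℕP.*-comm k m) ⟩
    + (m ℕ.* k)             ≡⟨ ℤP.pos-* m k ⟩
    + m ℤ.* + k             ≡⟨ cong (ℤ._* + k) (ℤP.*-identityʳ (+ m)) ⟨
    (+ m ℤ.* + 1) ℤ.* + k   ∎

+-cancel-<-≤ : ∀ {a b c e} → c ≤ a → a + b < c + e → b < e
+-cancel-<-≤ c≤a ab<ce = ≰⇒> λ e≤b → <-irrefl refl (<-≤-trans ab<ce (+-mono-≤ c≤a e≤b))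

sumℚ-++ : ∀ xs ys → sumℚ (xs ++ ys) ≡ sumℚ xs + sumℚ ys
sumℚ-++ []       ys = sym (+-identityˡ (sumℚ ys))
sumℚ-++ (x ∷ xs) ys = trans (cong (_+_ x) (sumℚ-++ xs ys)) (sym (+-assoc x (sumℚ xs) (sumℚ ys)))

module _ {A : Set} (f : A → ℚ) where

  sumℚ-map-take-drop : ∀ n xs → sumℚ (map f xs) ≡ sumℚ (map f (take n xs)) + sumℚ (map f (drop n xs))
  sumℚ-map-take-drop n xs = begin
    sumℚ (map f xs)                                      ≡⟨ cong (sumℚ ∘ map f) (List.take++drop≡id n xs) ⟨
    sumℚ (map f (take n xs ++ drop n xs))                ≡⟨ cong sumℚ (List.map-++ f (take n xs) (drop n xs)) ⟩
    sumℚ (map f (take n xs) ++ map f (drop n xs))        ≡⟨ sumℚ-++ (map f (take n xs)) (map f (drop n xs)) ⟩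
    sumℚ (map f (take n xs)) + sumℚ (map f (drop n xs))  ∎
    where open ≡-Reasoning

  sumℚ-map-nonNeg : (∀ x → 0ℚ ≤ f x) → ∀ xs → 0ℚ ≤ sumℚ (map f xs)
  sumℚ-map-nonNeg f≥0 []       = ≤-refl
  sumℚ-map-nonNeg f≥0 (x ∷ xs) = +-mono-≤ (f≥0 x) (sumℚ-map-nonNeg f≥0 xs)

  sumℚ-map-pos : (∀ x → 0ℚ < f x) → ∀ x xs → 0ℚ < sumℚ (map f (x ∷ xs))
  sumℚ-map-pos f>0 x xs = +-mono-<-≤ (f>0 x) (sumℚ-map-nonNeg (<⇒≤ ∘ f>0) xs)

module _ {A : Set} (f : A → ℚ) (k : ℕ) (c d : ℚ) where

  length-drop-block : ∀ m (xs : List A) → length xs ≡ suc m ℕ.* k → length (drop k xs) ≡ m ℕ.* k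
  length-drop-block m xs len =
    trans (List.length-drop k xs) (trans (cong (ℕ._∸ k) len) (ℕP.m+n∸m≡n k (m ℕ.* k)))

  tail-sum< : ∀ m xs → sumℚ (map f xs) + suc m · d < suc m · c →
              c ≤ sumℚ (map f (take k xs)) + d → sumℚ (map f (drop k xs)) + m · d < m · c
  tail-sum< m xs total< c≤head = +-cancel-<-≤ c≤head (subst (_< c + m · c) split total<)
    where
    open ≡-Reasoning
    head = sumℚ (map f (take k xs))
    tail = sumℚ (map f (drop k xs))
    split : sumℚ (map f xs) + (d + m · d) ≡ (head + d) + (tail + m · d)
    split = begin
      sumℚ (map f xs) + (d + m · d)  ≡⟨ cong (_+ (d + m · d)) (sumℚ-map-take-drop f k xs) ⟩
      (head + tail) + (d + m · d)    ≡⟨ interchange head tail d (m · d) ⟩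
      (head + d) + (tail + m · d)    ∎

  sum<⇒∃block≤ : ∀ m xs → length xs ≡ m ℕ.* k → sumℚ (map f xs) + m · d < m · c →
                 ∃ λ j → j ℕ.+ k ℕ.≤ length xs × sumℚ (map f (take k (drop j xs))) + d ≤ c
  sum<⇒∃block≤ zero [] refl 0<0 = ⊥-elim (<-irrefl refl 0<0)
  sum<⇒∃block≤ (suc m) xs len total< with sumℚ (map f (take k xs)) + d ≤? c
  ... | yes head≤ = 0 , subst (k ℕ.≤_) (sym len) (ℕP.m≤m+n k (m ℕ.* k)) , head≤
  ... | no head≰
    with sum<⇒∃block≤ m (drop k xs) (length-drop-block m xs len) (tail-sum< m xs total< (<⇒≤ (≰⇒> head≰)))
  ...   | j , j+k≤ , block≤ =
    k ℕ.+ j , k+j+k≤ , subst (λ ys → sumℚ (map f (take k ys)) + d ≤ c) (List.drop-drop k j xs) block≤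
    where
    open ℕP.≤-Reasoning
    k+j+k≤ : k ℕ.+ j ℕ.+ k ℕ.≤ length xs
    k+j+k≤ = begin
      k ℕ.+ j ℕ.+ k    ≡⟨ ℕP.+-assoc k j k ⟩
      k ℕ.+ (j ℕ.+ k)  ≤⟨ ℕP.+-monoʳ-≤ k (subst (j ℕ.+ k ℕ.≤_) (length-drop-block m xs len) j+k≤) ⟩
      k ℕ.+ m ℕ.* k    ≡⟨ len ⟨
      length xs        ∎

length-take-of-drop≢[] : ∀ {A : Set} n (xs : List A) → drop n xs ≢ [] → length (take n xs) ≡ n
length-take-of-drop≢[] zero    xs       _       = refl
length-take-of-drop≢[] (suc n) []       drop≢[] = ⊥-elim (drop≢[] refl)
length-take-of-drop≢[] (suc n) (x ∷ xs) drop≢[] = cong suc (length-take-of-drop≢[] n xs drop≢[])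

module BPUPProperties (n : ℕ) (s : Fin n → ℚ) (M : ℕ) .{{_ : NonZero M}}
                      (k : ℕ) .{{_ : NonZero k}} (U : ℚ) where
  open BPUP n s M k U

  length-early : ∀ bin p → late bin p ≢ [] → length (early bin p) ≡ k ℕ.* M
  length-early bin p = length-take-of-drop≢[] (k ℕ.* M) (binOrder bin p)

  s~-pos : (∀ i → 0ℚ ≤ s i) → 0ℚ < U → ∀ i → 0ℚ < s~ i
  s~-pos s≥0 U>0 i = +-mono-≤-< (s≥0 i) (positive⁻¹ (U * (+ 1 / k)))
    where instance
      U-pos : ℚ.Positive U
      U-pos = ℚ.positive U>0
      U/k-pos : ℚ.Positive (U * (+ 1 / k))
      U/k-pos = pos*pos⇒pos U (+ 1 / k) {{normalize-pos 1 k}}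

  early-cost<load : (∀ i → 0ℚ ≤ s i) → 0ℚ < U → ∀ bin p → late bin p ≢ [] →
                    sumℚ (map s (early bin p)) + (+ length (early bin p) / k) * U < load bin p
  early-cost<load s≥0 U>0 bin p late≢[] with late bin p
  ... | []     = ⊥-elim (late≢[] refl)
  ... | i ∷ is = +-monoˡ-< C (subst (_< A + Σ) (+-identityʳ A) (+-monoʳ-< A Σ>0))
    where
    A = sumℚ (map s (early bin p))
    C = (+ length (early bin p) / k) * U
    Σ = sumℚ (map s~ (i ∷ is))
    Σ>0 : 0ℚ < Σ
    Σ>0 = sumℚ-map-pos s~ (s~-pos s≥0 U>0) i is

lemma11 : (n : ℕ) (s : Fin n → ℚ) (M : ℕ) .{{_ : NonZero M}} (k : ℕ) .{{_ : NonZero k}} (U : ℚ) →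
          (∀ i → 0ℚ ℚ.≤ s i × s i ℚ.≤ 1ℚ) → 0ℚ ℚ.< U → U ℚ.≤ 1ℚ →
          (bin : BPUP.Assignment n s M k U) → BPUP.Feasible n s M k U bin →
          (p : ℕ) → BPUP.late n s M k U bin p ≢ [] →
          ∃ λ j → j ℕ.+ k ℕ.≤ length (BPUP.early n s M k U bin p) ×
            sumℚ (map s (take k (drop j (BPUP.early n s M k U bin p)))) + U ℚ.≤ BPUP.ε n s M k U
lemma11 n s M k U s∈[0,1] U>0 _ bin feasible p late≢[] =
  sum<⇒∃block≤ s k ε U M E (trans |E|≡kM (ℕP.*-comm k M)) E-light
  where
  open BPUP n s M k U
  open BPUPProperties n s M k U
  E = early bin p
  |E|≡kM : length E ≡ k ℕ.* M
  |E|≡kM = length-early bin p late≢[]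
  E-light : sumℚ (map s E) + M · U < M · ε
  E-light = begin-strict
    sumℚ (map s E) + M · U                  ≡⟨ cong (_+_ (sumℚ (map s E))) ([k*m/k]*x≡m·x k M U) ⟨
    sumℚ (map s E) + (+ (k ℕ.* M) / k) * U  ≡⟨ cong (λ l → sumℚ (map s E) + (+ l / k) * U) |E|≡kM ⟨
    sumℚ (map s E) + (+ length E / k) * U   <⟨ early-cost<load (proj₁ ∘ s∈[0,1]) U>0 bin p late≢[] ⟩
    load bin p                              ≤⟨ feasible p ⟩
    1ℚ                                      ≡⟨ m·[1/m]≡1 M ⟨
    M · ε                                   ∎
    where open ≤-Reasoning
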